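{- An eulerian graph $G$ has a rooted $2$-odd decomposition if and only if $G$ is non-bipartite and has an even number of edges.
   Context: Graphs are finite and may have multiple edges and loops (a graph with a loop is non-bipartite). A graph is eulerian if it is connected and every vertex has even degree. A decomposition of a graph $G$ is a set of subgraphs whose edge sets partition $E(G)$. A $2$-odd decomposition is a decomposition $\{G_1,G_2\}$ in which each $G_i$ is an eulerian subgraph (a closed trail) with an odd number of edges; it is rooted if some vertex of $G$ lies in both $G_1$ and $G_2$. -}

module Defs where

open import Data.Nat using (ℕ; zero; suc; _+_; _*_)
open import Data.Nat.Divisibility using (_∣_)
open import Data.Fin using (Fin; _≟_)
open import Data.Bool using (Bool; true; false; not; if_then_else_)
open import Data.List using (List; map; allFin)
open import Data.Nat.ListAction using (sum)
open import Data.Product using (_×_; _,_; proj₁; proj₂; Σ; ∃)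
open import Data.Sum using (_⊎_)
open import Relation.Binary.PropositionalEquality using (_≡_; _≢_)
open import Relation.Nullary.Decidable using (⌊_⌋)

-- A finite multigraph (multiple edges and loops allowed):
-- vertices Fin n, edges Fin m, each edge has two ends (equal ends = loop).
record Graph : Set where
  field
    n    : ℕ
    m    : ℕ
    ends : Fin m → Fin n × Fin n

open Graph public

Vertex : Graph → Set
Vertex G = Fin (n G)

Edge : Graph → Set
Edge G = Fin (m G)

-- A set of edges of G (a subgraph, represented by its edge set; its vertex
-- set is the set of vertices incident with its edges).
EdgeSet : Graph → Set
EdgeSet G = Edge G → Bool

allEdges : (G : Graph) → EdgeSet G
allEdges G _ = true

complement : (G : Graph) → EdgeSet G → EdgeSet G
complement G S e = not (S e)

size : (G : Graph) → EdgeSet G → ℕ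
size G S = sum (map (λ e → if S e then 1 else 0) (allFin (m G)))

Incident : (G : Graph) → Edge G → Vertex G → Set
Incident G e v = proj₁ (ends G e) ≡ v ⊎ proj₂ (ends G e) ≡ v

-- number of ends of e at v (a loop at v contributes 2)
endsAt : (G : Graph) → Edge G → Vertex G → ℕ
endsAt G e v = (if ⌊ proj₁ (ends G e) ≟ v ⌋ then 1 else 0)
             + (if ⌊ proj₂ (ends G e) ≟ v ⌋ then 1 else 0)

degree : (G : Graph) → EdgeSet G → Vertex G → ℕ
degree G S v = sum (map (λ e → if S e then endsAt G e v else 0) (allFin (m G)))

InSub : (G : Graph) → EdgeSet G → Vertex G → Set
InSub G S v = Σ (Edge G) λ e → S e ≡ true × Incident G e v

data Reach (G : Graph) (S : EdgeSet G) : Vertex G → Vertex G → Set where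
  here : ∀ {v} → Reach G S v v
  step : ∀ {u w v} (e : Edge G) → S e ≡ true →
         (ends G e ≡ (u , w) ⊎ ends G e ≡ (w , u)) →
         Reach G S w v → Reach G S u v

-- G itself is connected: nonempty, any two vertices joined by a walk
Connected : Graph → Set
Connected G = Vertex G × (∀ (u v : Vertex G) → Reach G (allEdges G) u v)

EvenDegrees : (G : Graph) → EdgeSet G → Set
EvenDegrees G S = ∀ (v : Vertex G) → 2 ∣ degree G S v

Eulerian : Graph → Set
Eulerian G = Connected G × EvenDegrees G (allEdges G)

EulerianSub : (G : Graph) → EdgeSet G → Set
EulerianSub G S =
  (Σ (Vertex G) λ v → InSub G S v)
  × (∀ u v → InSub G S u → InSub G S v → Reach G S u v)
  × EvenDegrees G S

Odd : ℕ → Set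
Odd k = Σ ℕ λ j → k ≡ suc (2 * j)

OddEulerianSub : (G : Graph) → EdgeSet G → Set
OddEulerianSub G S = EulerianSub G S × Odd (size G S)

TwoOddDecomposition : (G : Graph) → EdgeSet G → Set
TwoOddDecomposition G S = OddEulerianSub G S × OddEulerianSub G (complement G S)

RootedTwoOddDecomposition : Graph → Set
RootedTwoOddDecomposition G =
  Σ (EdgeSet G) λ S → TwoOddDecomposition G S
    × (Σ (Vertex G) λ v → InSub G S v × InSub G (complement G S) v)

-- bipartite: a 2-colouring of the vertices with every edge bichromatic
-- (so a graph with a loop is not bipartite)
Bipartite : Graph → Set
Bipartite G = Σ (Vertex G → Bool) λ c →
  ∀ (e : Edge G) → c (proj₁ (ends G e)) ≢ c (proj₂ (ends G e))

Even : ℕ → Set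
Even k = 2 ∣ k

module Submission where

-- Necessity: if G is bipartite, every subgraph with even degrees has an even number of edges, since
-- each edge has exactly one end in a fixed colour class; so an odd eulerian part rules out a
-- bipartition, and two odd parts add up to an even number of edges.
-- Sufficiency: G has an Euler circuit C (grow a trail: an open trail extends at its start because
-- degrees are even, a closed trail missing an edge is rotated and extended using connectivity).
-- Going along C, either some vertex is revisited after an odd number of steps, giving a closed
-- subtrail B of odd length, or colouring each vertex by the parity of the steps at which C visits it
-- is consistent and 2-colours every edge of G. In the first case B and the rest of C, read from the
-- repeated vertex, are closed trails through that vertex; the rest is odd because the total is even.

open import Algebra.Properties.CommutativeMonoid.Sum as Sum using ()
open import Data.Bool using (Bool; true; false; not; if_then_else_)
open import Data.Bool.Properties using (⇔→≡)
open import Data.Fin using (Fin; zero; suc; _≟_)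
open import Data.Fin.Properties using (any?; all?; ¬∀⟶∃¬)
open import Data.List using (List; []; _∷_; _++_; map; allFin; tabulate; length)
open import Data.List.Membership.Propositional using (_∈_; _∉_)
open import Data.List.Membership.Propositional.Properties using (∈-++⁻)
open import Data.List.Properties using (map-tabulate)
open import Data.List.Relation.Binary.Permutation.Propositional
  using (_↭_; ↭-sym; ↭-trans; ↭-reflexive; ↭⇒↭ₛ)
open import Data.List.Relation.Binary.Permutation.Propositional.Properties
  using (∈-resp-↭; ++-comm; ↭-length; shifts; ++⁺ˡ)
open import Data.List.Relation.Binary.Permutation.Setoid.Properties using (Unique-resp-↭)
import Data.List.Relation.Unary.All as All
import Data.List.Relation.Unary.All.Properties as All
import Data.List.Relation.Unary.AllPairs as AllPairs
open import Data.List.Relation.Unary.Any using (here; there)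
open import Data.List.Relation.Unary.Unique.Propositional using (Unique; []; _∷_)
open import Data.List.Relation.Unary.Unique.Propositional.Properties using (Unique[x∷xs]⇒x∉xs)
import Data.Nat as ℕ
open import Data.Nat using (ℕ; zero; suc; _+_; _*_; _≤_; _<_; z≤n; s≤s; parity)
open import Data.Nat.Divisibility using (_∣_; divides; ∣m∣n⇒∣m+n)
open import Data.Nat.ListAction using (sum)
open import Data.Nat.Properties
  using (+-0-commutativeMonoid; +-identityʳ; +-suc; *-comm; *-suc; ≤-refl; ≤-trans; 1+n≰n; m≤n⇒m≤1+n)
open import Data.Parity.Base as ℙ using (Parity; 0ℙ; 1ℙ; _⁻¹)
open import Data.Parity.Properties as ℙ using (+-homo-+; p+p≡0ℙ)
open import Data.Product using (Σ; _×_; _,_; proj₁; proj₂)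
open import Data.Sum using (_⊎_; inj₁; inj₂)
open import Function using (_∘_)
open import Function.Bundles using (_⇔_; mk⇔)
open import Relation.Binary.PropositionalEquality
open import Relation.Nullary using (¬_; Dec; yes; no; does; contradiction; ¬?; _×-dec_)
open import Relation.Nullary.Decidable using (⌊_⌋; ⌊⌋-map′; dec-true; dec-false)

open import Defs

open ≡-Reasoning
open Sum +-0-commutativeMonoid
  using (sum-syntax; sum-cong-≗; sum-replicate-zero; ∑-distrib-+; ∑-comm) renaming (sum to ∑)

parity[q*2] : ∀ q → parity (q * 2) ≡ 0ℙ
parity[q*2] zero    = refl
parity[q*2] (suc q) = parity[q*2] q

2∣⇒parity≡0ℙ : ∀ {k} → 2 ∣ k → parity k ≡ 0ℙ
2∣⇒parity≡0ℙ (divides q refl) = parity[q*2] q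

parity≡0ℙ⇒2∣ : ∀ k → parity k ≡ 0ℙ → 2 ∣ k
parity≡0ℙ⇒2∣ zero          _ = divides 0 refl
parity≡0ℙ⇒2∣ (suc (suc k)) p with parity≡0ℙ⇒2∣ k p
... | divides q k≡q*2 = divides (suc q) (cong (2 +_) k≡q*2)

Odd⇒parity≡1ℙ : ∀ {k} → Odd k → parity k ≡ 1ℙ
Odd⇒parity≡1ℙ (j , refl) =
  trans (+-homo-+ 1 (2 * j)) (cong (1ℙ ℙ.+_) (2∣⇒parity≡0ℙ (divides j (*-comm 2 j))))

parity≡1ℙ⇒Odd : ∀ k → parity k ≡ 1ℙ → Odd k
parity≡1ℙ⇒Odd (suc zero)    _ = 0 , refl
parity≡1ℙ⇒Odd (suc (suc k)) p with parity≡1ℙ⇒Odd k p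
... | j , refl = suc j , cong suc (sym (*-suc 2 j))

Odd⇒positive : ∀ {k} → Odd k → 0 < k
Odd⇒positive (_ , refl) = s≤s z≤n

Odd⇒¬2∣ : ∀ {k} → Odd k → ¬ 2 ∣ k
Odd⇒¬2∣ odd 2∣k = contradiction (trans (sym (Odd⇒parity≡1ℙ odd)) (2∣⇒parity≡0ℙ 2∣k)) λ ()

Odd+Odd⇒2∣ : ∀ {a b} → Odd a → Odd b → 2 ∣ a + b
Odd+Odd⇒2∣ {a} {b} oddA oddB =
  parity≡0ℙ⇒2∣ (a + b) (trans (+-homo-+ a b) (cong₂ ℙ._+_ (Odd⇒parity≡1ℙ oddA) (Odd⇒parity≡1ℙ oddB)))

2∣+Odd⇒Odd : ∀ {a b} → 2 ∣ a + b → Odd a → Odd b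
2∣+Odd⇒Odd {a} {b} 2∣a+b oddA =
  parity≡1ℙ⇒Odd b (trans (sym (ℙ.⁻¹-involutive (parity b))) (cong _⁻¹ parity[b]⁻¹≡0ℙ))
  where
  parity[b]⁻¹≡0ℙ : parity b ⁻¹ ≡ 0ℙ
  parity[b]⁻¹≡0ℙ = begin
    1ℙ ℙ.+ parity b        ≡⟨ cong (ℙ._+ parity b) (sym (Odd⇒parity≡1ℙ oddA)) ⟩
    parity a ℙ.+ parity b  ≡⟨ sym (+-homo-+ a b) ⟩
    parity (a + b)         ≡⟨ 2∣⇒parity≡0ℙ 2∣a+b ⟩
    0ℙ                     ∎

+-cancel-middle : ∀ a b c → (a ℙ.+ b) ℙ.+ (b ℙ.+ c) ≡ a ℙ.+ c
+-cancel-middle a b c = begin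
  (a ℙ.+ b) ℙ.+ (b ℙ.+ c)  ≡⟨ ℙ.+-assoc a b _ ⟩
  a ℙ.+ (b ℙ.+ (b ℙ.+ c))  ≡⟨ cong (a ℙ.+_) (sym (ℙ.+-assoc b b c)) ⟩
  a ℙ.+ ((b ℙ.+ b) ℙ.+ c)  ≡⟨ cong (λ p → a ℙ.+ (p ℙ.+ c)) (p+p≡0ℙ b) ⟩
  a ℙ.+ c                  ∎

sum-tabulate : ∀ {n} (f : Fin n → ℕ) → sum (tabulate f) ≡ ∑ f
sum-tabulate {zero}  f = refl
sum-tabulate {suc n} f = cong (f zero +_) (sum-tabulate (f ∘ suc))

sum-map-allFin : ∀ {n} (f : Fin n → ℕ) → sum (map f (allFin n)) ≡ ∑ f
sum-map-allFin f = trans (cong sum (map-tabulate (λ i → i) f)) (sum-tabulate f)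

sum-map-const1 : ∀ {A : Set} (xs : List A) → sum (map (λ _ → 1) xs) ≡ length xs
sum-map-const1 []       = refl
sum-map-const1 (_ ∷ xs) = cong suc (sum-map-const1 xs)

∑-indicator : ∀ {n} (f : Fin n → ℕ) j → ∑[ i < n ] (if ⌊ j ≟ i ⌋ then f i else 0) ≡ f j
∑-indicator {suc n} f zero    = trans (cong (f zero +_) (sum-replicate-zero n)) (+-identityʳ _)
∑-indicator {suc n} f (suc j) = trans (sum-cong-≗ shift) (∑-indicator (f ∘ suc) j)
  where
  shift : ∀ i → (if ⌊ suc j ≟ suc i ⌋ then f (suc i) else 0) ≡ (if ⌊ j ≟ i ⌋ then f (suc i) else 0)
  shift i = cong (if_then f (suc i) else 0) (⌊⌋-map′ _ _ (j ≟ i))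

∑-indicator≤ : ∀ {n} (S : Fin n → Bool) → ∑[ i < n ] (if S i then 1 else 0) ≤ n
∑-indicator≤ {zero}  S = z≤n
∑-indicator≤ {suc n} S with S zero
... | true  = s≤s (∑-indicator≤ (S ∘ suc))
... | false = m≤n⇒m≤1+n (∑-indicator≤ (S ∘ suc))

∑-if-split : ∀ {n} (S : Fin n → Bool) (f : Fin n → ℕ) →
             ∑ f ≡ ∑[ i < n ] (if S i then f i else 0) + ∑[ i < n ] (if not (S i) then f i else 0)
∑-if-split S f = trans (sum-cong-≗ split) (∑-distrib-+ (λ i → if S i then f i else 0) _)
  where
  split : ∀ i → f i ≡ (if S i then f i else 0) + (if not (S i) then f i else 0)
  split i with S i
  ... | true  = sym (+-identityʳ (f i))
  ... | false = refl

if-∑ : ∀ {n} (b : Bool) (f : Fin n → ℕ) → (if b then ∑ f else 0) ≡ ∑[ i < n ] (if b then f i else 0)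
if-∑     true  f = refl
if-∑ {n} false f = sym (sum-replicate-zero n)

if-if-comm : ∀ (a b : Bool) (x : ℕ) →
             (if a then (if b then x else 0) else 0) ≡ (if b then (if a then x else 0) else 0)
if-if-comm true  true  x = refl
if-if-comm true  false x = refl
if-if-comm false true  x = refl
if-if-comm false false x = refl

∑-even : ∀ {n} (f : Fin n → ℕ) → (∀ i → 2 ∣ f i) → 2 ∣ ∑ f
∑-even {zero}  f _    = divides 0 refl
∑-even {suc n} f even = ∣m∣n⇒∣m+n (even zero) (∑-even (f ∘ suc) (even ∘ suc))

unique-∷ : ∀ {A : Set} {x : A} {xs} → x ∉ xs → Unique xs → Unique (x ∷ xs)
unique-∷ x∉xs unique = All.¬Any⇒All¬ _ x∉xs ∷ unique

unique-↭ : ∀ {A : Set} {xs ys : List A} → xs ↭ ys → Unique xs → Unique ys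
unique-↭ {A} xs↭ys = Unique-resp-↭ (setoid A) (↭⇒↭ₛ xs↭ys)

unique-++⁻ : ∀ {A : Set} (xs : List A) {ys} → Unique (xs ++ ys) →
             Unique xs × Unique ys × (∀ {x} → x ∈ xs → x ∉ ys)
unique-++⁻ []       unique = [] , unique , λ ()
unique-++⁻ (x ∷ xs) (x≢ ∷ unique) with unique-++⁻ xs unique
... | uniqueXs , uniqueYs , disjoint = All.++⁻ˡ xs x≢ ∷ uniqueXs , uniqueYs , λ
  { (here refl)  x∈ys → All.lookup (All.++⁻ʳ xs x≢) x∈ys refl
  ; (there x∈xs)      → disjoint x∈xs }

-- The decision procedure is instantiated for each n, since with _≟_ unapplied its index stays unsolved.
module _ {n : ℕ} where
  open import Data.List.Membership.DecPropositional (_≟_ {n = n}) using (_∈?_) public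

record Enumeration {n} (S : Fin n → Bool) (L : List (Fin n)) : Set where
  field
    unique   : Unique L
    sound    : ∀ {i} → i ∈ L → S i ≡ true
    complete : ∀ {i} → S i ≡ true → i ∈ L

_∈ᵇ_ : ∀ {n} → Fin n → List (Fin n) → Bool
i ∈ᵇ L = does (i ∈? L)

∈ᵇ-enumeration : ∀ {n} {L : List (Fin n)} → Unique L → Enumeration (_∈ᵇ L) L
∈ᵇ-enumeration {L = L} unique = record { unique = unique ; sound = dec-true (_ ∈? L) ; complete = complete }
  where
  complete : ∀ {i} → i ∈ᵇ L ≡ true → i ∈ L
  complete {i} i∈ᵇL with i ∈? L
  ... | yes i∈L = i∈L
  ... | no _    = contradiction i∈ᵇL λ ()

∑-enumeration : ∀ {n} {S : Fin n → Bool} {L} (f : Fin n → ℕ) → Enumeration S L →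
                ∑[ i < n ] (if S i then f i else 0) ≡ sum (map f L)
∑-enumeration {n} {S} {[]} f E = trans (sum-cong-≗ vanish) (sum-replicate-zero n)
  where
  vanish : ∀ i → (if S i then f i else 0) ≡ 0
  vanish i with S i in S[i]
  ... | true  = contradiction (Enumeration.complete E S[i]) λ ()
  ... | false = refl
∑-enumeration {n} {S} {x ∷ L} f E = begin
  ∑[ i < n ] (if S i then f i else 0)
    ≡⟨ sum-cong-≗ separate ⟩
  ∑[ i < n ] ((if ⌊ x ≟ i ⌋ then f i else 0) + (if i ∈ᵇ L then f i else 0))
    ≡⟨ ∑-distrib-+ (λ i → if ⌊ x ≟ i ⌋ then f i else 0) (λ i → if i ∈ᵇ L then f i else 0) ⟩
  ∑[ i < n ] (if ⌊ x ≟ i ⌋ then f i else 0) + ∑[ i < n ] (if i ∈ᵇ L then f i else 0)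
    ≡⟨ cong₂ _+_ (∑-indicator f x) (∑-enumeration f tail) ⟩
  f x + sum (map f L) ∎
  where
  open Enumeration E
  tail : Enumeration (_∈ᵇ L) L
  tail = ∈ᵇ-enumeration (AllPairs.tail unique)
  separate : ∀ i → (if S i then f i else 0) ≡ (if ⌊ x ≟ i ⌋ then f i else 0) + (if i ∈ᵇ L then f i else 0)
  separate i with x ≟ i
  ... | yes refl rewrite sound (here refl) | dec-false (x ∈? L) (Unique[x∷xs]⇒x∉xs unique) =
    sym (+-identityʳ (f x))
  ... | no x≢i = cong (if_then f i else 0) (⇔→≡ (mk⇔ S→L (sound ∘ there ∘ Enumeration.complete tail)))
    where
    S→L : S i ≡ true → i ∈ᵇ L ≡ true
    S→L S[i] with complete S[i]
    ... | here i≡x  = contradiction (sym i≡x) x≢i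
    ... | there i∈L = dec-true (i ∈? L) i∈L

unique⇒length≤ : ∀ {n} {L : List (Fin n)} → Unique L → length L ≤ n
unique⇒length≤ {n} {L} unique = subst (_≤ n) count (∑-indicator≤ (_∈ᵇ L))
  where
  count : ∑[ i < n ] (if i ∈ᵇ L then 1 else 0) ≡ length L
  count = trans (∑-enumeration (λ _ → 1) (∈ᵇ-enumeration unique)) (sum-map-const1 L)

partition-enumeration : ∀ {n} (L : List (Fin n)) {K} → Unique (L ++ K) → (∀ i → i ∈ L ++ K) →
                        Enumeration (_∈ᵇ L) L × Enumeration (λ i → not (i ∈ᵇ L)) K
partition-enumeration L {K} unique covers with unique-++⁻ L unique
... | uniqueL , uniqueK , disjoint = ∈ᵇ-enumeration uniqueL , record
  { unique   = uniqueK
  ; sound    = λ {i} i∈K → cong not (dec-false (i ∈? L) (λ i∈L → disjoint i∈L i∈K))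
  ; complete = complete
  }
  where
  complete : ∀ {i} → not (i ∈ᵇ L) ≡ true → i ∈ K
  complete {i} i∉ᵇL with ∈-++⁻ L (covers i)
  ... | inj₂ i∈K = i∈K
  ... | inj₁ i∈L = contradiction (trans (sym (cong not (dec-true (i ∈? L) i∈L))) i∉ᵇL) λ ()

module _ (G : Graph) where

  -- Walks

  Joins : Edge G → Vertex G → Vertex G → Set
  Joins e u w = ends G e ≡ (u , w) ⊎ ends G e ≡ (w , u)

  joins-sym : ∀ {e u w} → Joins e u w → Joins e w u
  joins-sym (inj₁ p) = inj₂ p
  joins-sym (inj₂ p) = inj₁ p

  joins⇒incident : ∀ {e u w} → Joins e u w → Incident G e u
  joins⇒incident (inj₁ p) = inj₁ (cong proj₁ p)
  joins⇒incident (inj₂ p) = inj₂ (cong proj₂ p)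

  incident-joins : ∀ {e u w v} → Joins e u w → Incident G e v → v ≡ u ⊎ v ≡ w
  incident-joins (inj₁ p) (inj₁ q) = inj₁ (trans (sym q) (cong proj₁ p))
  incident-joins (inj₁ p) (inj₂ q) = inj₂ (trans (sym q) (cong proj₂ p))
  incident-joins (inj₂ p) (inj₁ q) = inj₂ (trans (sym q) (cong proj₁ p))
  incident-joins (inj₂ p) (inj₂ q) = inj₁ (trans (sym q) (cong proj₂ p))

  endsAt≢0⇒joins : ∀ {f z} → endsAt G f z ≢ 0 → Σ (Vertex G) λ w → Joins f w z
  endsAt≢0⇒joins {f} {z} endsAt≢0 with proj₁ (ends G f) ≟ z
  ... | yes refl = proj₂ (ends G f) , inj₂ refl
  ... | no _ with proj₂ (ends G f) ≟ z
  ...   | yes refl = proj₁ (ends G f) , inj₁ refl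
  ...   | no _     = contradiction refl endsAt≢0

  -- A walk is a reachability derivation in G itself; it is a trail when its edge list is Unique.
  Walk : Vertex G → Vertex G → Set
  Walk = Reach G (allEdges G)

  edges : ∀ {S u v} → Reach G S u v → List (Edge G)
  edges here           = []
  edges (step e _ _ W) = e ∷ edges W

  _++ʷ_ : ∀ {S u w v} → Reach G S u w → Reach G S w v → Reach G S u v
  here         ++ʷ Q = Q
  step e s d P ++ʷ Q = step e s d (P ++ʷ Q)

  edges-++ʷ : ∀ {S u w v} (P : Reach G S u w) (Q : Reach G S w v) → edges (P ++ʷ Q) ≡ edges P ++ edges Q
  edges-++ʷ here           Q = refl
  edges-++ʷ (step e _ _ P) Q = cong (e ∷_) (edges-++ʷ P Q)

  ∈-++ʷ⁺ˡ : ∀ {S u w v e} (P : Reach G S u w) {Q : Reach G S w v} → e ∈ edges P → e ∈ edges (P ++ʷ Q)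
  ∈-++ʷ⁺ˡ (step _ _ _ P) (here e≡)   = here e≡
  ∈-++ʷ⁺ˡ (step _ _ _ P) (there e∈P) = there (∈-++ʷ⁺ˡ P e∈P)

  ∈-++ʷ⁺ʳ : ∀ {S u w v e} (P : Reach G S u w) {Q : Reach G S w v} → e ∈ edges Q → e ∈ edges (P ++ʷ Q)
  ∈-++ʷ⁺ʳ here           e∈Q = e∈Q
  ∈-++ʷ⁺ʳ (step _ _ _ P) e∈Q = there (∈-++ʷ⁺ʳ P e∈Q)

  restrict : ∀ {S u v} (W : Walk u v) → (∀ {e} → e ∈ edges W → S e ≡ true) → Reach G S u v
  restrict here           _   = here
  restrict (step e _ d W) inS = step e (inS (here refl)) d (restrict W (inS ∘ there))

  data Visits : ∀ {u b} → Walk u b → ℕ → Vertex G → Set where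
    start : ∀ {u b} {W : Walk u b} → Visits W 0 u
    later : ∀ {u w b e s d k v} {W : Walk w b} → Visits W k v → Visits (step {u = u} e s d W) (suc k) v

  Visited : ∀ {u b} → Walk u b → Vertex G → Set
  Visited W v = Σ ℕ λ k → Visits W k v

  visits? : ∀ {u b} (W : Walk u b) v → Dec (Visited W v)
  visits? {u} W v with u ≟ v
  ... | yes refl = yes (0 , start)
  visits? here v           | no u≢v = no λ { (_ , start) → u≢v refl }
  visits? (step e s d W) v | no u≢v with visits? W v
  ... | yes (k , visit) = yes (suc k , later visit)
  ... | no ¬visit       = no λ { (_ , start) → u≢v refl ; (suc k , later visit) → ¬visit (k , visit) }

  split : ∀ {u b k v} {W : Walk u b} → Visits W k v →
          Σ (Walk u v) λ P → Σ (Walk v b) λ Q → P ++ʷ Q ≡ W × length (edges P) ≡ k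
  split {W = W} start = here , W , refl , refl
  split (later {e = e} {s = s} {d = d} visit) with split visit
  ... | P , Q , refl , refl = step e s d P , Q , refl , refl

  rotate : ∀ {x z} (T : Walk x x) → Visited T z → Σ (Walk z z) λ T′ → edges T′ ↭ edges T
  rotate T (_ , visit) with split visit
  ... | P , Q , refl , _ = Q ++ʷ P ,
    ↭-trans (↭-reflexive (edges-++ʷ Q P))
            (↭-trans (++-comm (edges Q) (edges P)) (↭-reflexive (sym (edges-++ʷ P Q))))

  edge-visits : ∀ {u b e} (W : Walk u b) → e ∈ edges W →
                Σ ℕ λ k → Σ (Vertex G) λ x → Σ (Vertex G) λ y →
                  Joins e x y × Visits W k x × Visits W (suc k) y
  edge-visits (step e _ d W) (here refl) = 0 , _ , _ , d , start , later start
  edge-visits (step e _ d W) (there e∈W) with edge-visits W e∈W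
  ... | k , x , y , joins , visitX , visitY = suc k , x , y , joins , later visitX , later visitY

  incident-visited : ∀ {u b e v} (W : Walk u b) → e ∈ edges W → Incident G e v → Visited W v
  incident-visited W e∈W incident with edge-visits W e∈W
  ... | k , x , y , joins , visitX , visitY with incident-joins joins incident
  ...   | inj₁ refl = k , visitX
  ...   | inj₂ refl = suc k , visitY

  δ : Vertex G → Vertex G → ℕ
  δ u x = if ⌊ u ≟ x ⌋ then 1 else 0

  δ-self : ∀ u → δ u u ≡ 1
  δ-self u with u ≟ u
  ... | yes _   = refl
  ... | no u≢u = contradiction refl u≢u

  δ-other : ∀ {u x} → u ≢ x → δ u x ≡ 0
  δ-other {u} {x} u≢x with u ≟ x
  ... | yes u≡x = contradiction u≡x u≢x
  ... | no _    = refl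

  endsAlong : ∀ {S u v} → Reach G S u v → Vertex G → ℕ
  endsAlong W x = sum (map (λ e → endsAt G e x) (edges W))

  parity-endsAt : ∀ {e u w} x → Joins e u w → parity (endsAt G e x) ≡ parity (δ u x) ℙ.+ parity (δ w x)
  parity-endsAt {u = u} {w} x (inj₁ p) rewrite p = +-homo-+ (δ u x) (δ w x)
  parity-endsAt {u = u} {w} x (inj₂ p) rewrite p =
    trans (+-homo-+ (δ w x) (δ u x)) (ℙ.+-comm (parity (δ w x)) (parity (δ u x)))

  parity-endsAlong : ∀ {S u v} (W : Reach G S u v) x →
                     parity (endsAlong W x) ≡ parity (δ u x) ℙ.+ parity (δ v x)
  parity-endsAlong {u = u} here x = sym (p+p≡0ℙ (parity (δ u x)))
  parity-endsAlong {u = u} {v} (step {w = w} e _ d W) x = begin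
    parity (endsAt G e x + endsAlong W x)             ≡⟨ +-homo-+ (endsAt G e x) _ ⟩
    parity (endsAt G e x) ℙ.+ parity (endsAlong W x)  ≡⟨ cong₂ ℙ._+_ (parity-endsAt x d) (parity-endsAlong W x) ⟩
    (pu ℙ.+ pw) ℙ.+ (pw ℙ.+ pv)                       ≡⟨ +-cancel-middle pu pw pv ⟩
    pu ℙ.+ pv                                         ∎
    where
    pu pw pv : Parity
    pu = parity (δ u x)
    pw = parity (δ w x)
    pv = parity (δ v x)

  closed⇒2∣endsAlong : ∀ {S u} (W : Reach G S u u) x → 2 ∣ endsAlong W x
  closed⇒2∣endsAlong {u = u} W x =
    parity≡0ℙ⇒2∣ _ (trans (parity-endsAlong W x) (p+p≡0ℙ (parity (δ u x))))

  open⇒¬2∣endsAlong : ∀ {S u v} → u ≢ v → (W : Reach G S u v) → ¬ 2 ∣ endsAlong W u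
  open⇒¬2∣endsAlong {u = u} {v} u≢v W 2∣ = contradiction (trans (sym (2∣⇒parity≡0ℙ 2∣)) odd) λ ()
    where
    odd : parity (endsAlong W u) ≡ 1ℙ
    odd = trans (parity-endsAlong W u)
                (cong₂ (λ a b → parity a ℙ.+ parity b) (δ-self u) (δ-other (u≢v ∘ sym)))

  size-enumeration : ∀ {S L} → Enumeration S L → size G S ≡ length L
  size-enumeration {S} {L} E = begin
    size G S                             ≡⟨ sum-map-allFin {m G} (λ e → if S e then 1 else 0) ⟩
    ∑[ e < m G ] (if S e then 1 else 0)  ≡⟨ ∑-enumeration (λ _ → 1) E ⟩
    sum (map (λ _ → 1) L)                ≡⟨ sum-map-const1 L ⟩
    length L                             ∎

  degree-enumeration : ∀ {S L} v → Enumeration S L → degree G S v ≡ sum (map (λ e → endsAt G e v) L)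
  degree-enumeration {S} v E =
    trans (sum-map-allFin {m G} (λ e → if S e then endsAt G e v else 0))
          (∑-enumeration (λ e → endsAt G e v) E)

  size-split : ∀ S → size G (allEdges G) ≡ size G S + size G (complement G S)
  size-split S = begin
    size G (allEdges G)  ≡⟨ sum-map-allFin {m G} (λ _ → 1) ⟩
    ∑[ e < m G ] 1       ≡⟨ ∑-if-split S (λ _ → 1) ⟩
    ∑[ e < m G ] (if S e then 1 else 0) + ∑[ e < m G ] (if not (S e) then 1 else 0)
      ≡⟨ sym (cong₂ _+_ (sum-map-allFin {m G} (λ e → if S e then 1 else 0))
                        (sum-map-allFin {m G} (λ e → if not (S e) then 1 else 0))) ⟩
    size G S + size G (complement G S) ∎

  degree-split : ∀ S v → degree G (allEdges G) v ≡ degree G S v + degree G (complement G S) v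
  degree-split S v = begin
    degree G (allEdges G) v    ≡⟨ sum-map-allFin {m G} (λ e → endsAt G e v) ⟩
    ∑[ e < m G ] endsAt G e v  ≡⟨ ∑-if-split S (λ e → endsAt G e v) ⟩
    ∑[ e < m G ] (if S e then endsAt G e v else 0) + ∑[ e < m G ] (if not (S e) then endsAt G e v else 0)
      ≡⟨ sym (cong₂ _+_ (sum-map-allFin {m G} (λ e → if S e then endsAt G e v else 0))
                        (sum-map-allFin {m G} (λ e → if not (S e) then endsAt G e v else 0))) ⟩
    degree G S v + degree G (complement G S) v ∎

  closedTrail⇒eulerianSub : ∀ {S a} (W : Walk a a) → Enumeration S (edges W) → InSub G S a → EulerianSub G S
  closedTrail⇒eulerianSub {S} {a} W E a∈S = (a , a∈S) , connected , evenDegrees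
    where
    open Enumeration E
    around : ∀ {u} → InSub G S u → Σ (Walk a u) λ P → Σ (Walk u a) λ Q → P ++ʷ Q ≡ W
    around (e , S[e] , incident) with split (proj₂ (incident-visited W (complete S[e]) incident))
    ... | P , Q , P++Q≡W , _ = P , Q , P++Q≡W
    connected : ∀ u v → InSub G S u → InSub G S v → Reach G S u v
    connected u v u∈S v∈S with around u∈S | around v∈S
    ... | P , Q , P++Q≡W | P′ , Q′ , P′++Q′≡W =
      restrict Q (λ {e} e∈Q → sound (subst (λ X → e ∈ edges X) P++Q≡W (∈-++ʷ⁺ʳ P e∈Q)))
      ++ʷ restrict P′ (λ {e} e∈P′ → sound (subst (λ X → e ∈ edges X) P′++Q′≡W (∈-++ʷ⁺ˡ P′ e∈P′)))
    evenDegrees : EvenDegrees G S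
    evenDegrees v = subst (2 ∣_) (sym (degree-enumeration v E)) (closed⇒2∣endsAlong W v)

  start-inSub : ∀ {S a b} (W : Walk a b) → (∀ {e} → e ∈ edges W → S e ≡ true) → 0 < length (edges W) →
                InSub G S a
  start-inSub (step e _ d W) inS _ = e , inS (here refl) , joins⇒incident d

  oddClosedTrail⇒rootedOddEulerianSub : ∀ {S a} (W : Walk a a) → Enumeration S (edges W) → Odd (size G S) →
                                        OddEulerianSub G S × InSub G S a
  oddClosedTrail⇒rootedOddEulerianSub {S} {a} W E odd = (closedTrail⇒eulerianSub W E a∈S , odd) , a∈S
    where
    a∈S : InSub G S a
    a∈S = start-inSub W (Enumeration.sound E) (subst (0 <_) (size-enumeration E) (Odd⇒positive odd))

  -- Bipartite graphs

  colourClass-ends : (c : Vertex G → Bool) (e : Edge G) →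
                     ∑[ v < n G ] (if c v then endsAt G e v else 0)
                       ≡ (if c (proj₁ (ends G e)) then 1 else 0) + (if c (proj₂ (ends G e)) then 1 else 0)
  colourClass-ends c e = begin
    ∑[ v < n G ] (if c v then endsAt G e v else 0)
      ≡⟨ sum-cong-≗ distribute ⟩
    ∑[ v < n G ] ((if c v then δ x v else 0) + (if c v then δ y v else 0))
      ≡⟨ ∑-distrib-+ (λ v → if c v then δ x v else 0) (λ v → if c v then δ y v else 0) ⟩
    ∑[ v < n G ] (if c v then δ x v else 0) + ∑[ v < n G ] (if c v then δ y v else 0)
      ≡⟨ cong₂ _+_ (inClass x) (inClass y) ⟩
    (if c x then 1 else 0) + (if c y then 1 else 0) ∎
    where
    x y : Vertex G
    x = proj₁ (ends G e)
    y = proj₂ (ends G e)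
    distribute : ∀ v → (if c v then endsAt G e v else 0)
                         ≡ (if c v then δ x v else 0) + (if c v then δ y v else 0)
    distribute v with c v
    ... | true  = refl
    ... | false = refl
    inClass : ∀ z → ∑[ v < n G ] (if c v then δ z v else 0) ≡ (if c z then 1 else 0)
    inClass z = trans (sum-cong-≗ (λ v → if-if-comm (c v) ⌊ z ≟ v ⌋ 1))
                      (∑-indicator (λ v → if c v then 1 else 0) z)

  -- Double counting: size G S is the total S-degree of the colour class of c.
  bipartite⇒2∣size : Bipartite G → ∀ S → EvenDegrees G S → 2 ∣ size G S
  bipartite⇒2∣size (c , bichromatic) S evenDegrees =
    subst (2 ∣_) (sym count) (∑-even (λ v → if c v then degree G S v else 0) evenTerm)
    where
    endsInClass : Edge G → Vertex G → ℕ
    endsInClass e v = if c v then endsAt G e v else 0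
    oneEnd : ∀ {a b} → a ≢ b → (if a then 1 else 0) + (if b then 1 else 0) ≡ 1
    oneEnd {true}  {true}  a≢b = contradiction refl a≢b
    oneEnd {true}  {false} _   = refl
    oneEnd {false} {true}  _   = refl
    oneEnd {false} {false} a≢b = contradiction refl a≢b
    oneEndInClass : ∀ e → ∑[ v < n G ] endsInClass e v ≡ 1
    oneEndInClass e = trans (colourClass-ends c e) (oneEnd (bichromatic e))
    count : size G S ≡ ∑[ v < n G ] (if c v then degree G S v else 0)
    count = begin
      size G S
        ≡⟨ sum-map-allFin {m G} (λ e → if S e then 1 else 0) ⟩
      ∑[ e < m G ] (if S e then 1 else 0)
        ≡⟨ sum-cong-≗ (λ e → cong (if S e then_else 0) (sym (oneEndInClass e))) ⟩
      ∑[ e < m G ] (if S e then ∑[ v < n G ] endsInClass e v else 0)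
        ≡⟨ sum-cong-≗ (λ e → if-∑ {n G} (S e) (endsInClass e)) ⟩
      ∑[ e < m G ] ∑[ v < n G ] (if S e then endsInClass e v else 0)
        ≡⟨ ∑-comm (λ e v → if S e then endsInClass e v else 0) ⟩
      ∑[ v < n G ] ∑[ e < m G ] (if S e then endsInClass e v else 0)
        ≡⟨ sum-cong-≗ (λ v → sum-cong-≗ (λ e → if-if-comm (S e) (c v) (endsAt G e v))) ⟩
      ∑[ v < n G ] ∑[ e < m G ] (if c v then (if S e then endsAt G e v else 0) else 0)
        ≡⟨ sum-cong-≗ (λ v → sym (if-∑ {m G} (c v) (λ e → if S e then endsAt G e v else 0))) ⟩
      ∑[ v < n G ] (if c v then ∑[ e < m G ] (if S e then endsAt G e v else 0) else 0)
        ≡⟨ sum-cong-≗ (λ v → cong (if c v then_else 0)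
                                  (sym (sum-map-allFin {m G} (λ e → if S e then endsAt G e v else 0)))) ⟩
      ∑[ v < n G ] (if c v then degree G S v else 0) ∎
    evenTerm : ∀ v → 2 ∣ (if c v then degree G S v else 0)
    evenTerm v with c v
    ... | true  = evenDegrees v
    ... | false = divides 0 refl

  -- Odd closed segments versus 2-colourings

  OddClosedSegment : ∀ {u b} → Walk u b → Set
  OddClosedSegment {u} {b} W = Σ (Vertex G) λ a → Σ (Walk u a) λ A → Σ (Walk a a) λ B → Σ (Walk a b) λ Q →
    A ++ʷ (B ++ʷ Q) ≡ W × Odd (length (edges B))

  ParityColouring : ∀ {u b} → Walk u b → Set
  ParityColouring {u} W = Σ (Vertex G → Parity) λ c → ∀ {k v} → Visits W k v → c v ≡ c u ℙ.+ parity k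

  extend-parityColouring : ∀ {u w b e s d} {W : Walk w b} (c : Vertex G → Parity) → c u ≡ c w ℙ.+ 1ℙ →
                           (∀ {k v} → Visits W k v → c v ≡ c w ℙ.+ parity k) →
                           ParityColouring (step {u = u} e s d W)
  extend-parityColouring {u} {w} c cu colours = c , λ
    { start → sym (ℙ.+-identityʳ (c u))
    ; (later {k = k} {v = v} visit) → begin
        c v                                 ≡⟨ colours visit ⟩
        c w ℙ.+ parity k                    ≡⟨ sym (+-cancel-middle (c w) 1ℙ (parity k)) ⟩
        (c w ℙ.+ 1ℙ) ℙ.+ (1ℙ ℙ.+ parity k)  ≡⟨ cong₂ ℙ._+_ (sym cu) (sym (+-homo-+ 1 k)) ⟩
        c u ℙ.+ parity (suc k)              ∎ }

  recolour : ∀ {w b u} (W : Walk w b) → ¬ Visited W u → (c : Vertex G → Parity) (p : Parity) →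
             Σ (Vertex G → Parity) λ c′ → c′ u ≡ p × (∀ {k v} → Visits W k v → c′ v ≡ c v)
  recolour {u = u} W unvisited c p = c′ , c′u , agree
    where
    c′ : Vertex G → Parity
    c′ v = if ⌊ v ≟ u ⌋ then p else c v
    c′u : c′ u ≡ p
    c′u with u ≟ u
    ... | yes _   = refl
    ... | no u≢u = contradiction refl u≢u
    agree : ∀ {k v} → Visits W k v → c′ v ≡ c v
    agree {k} {v} visit with v ≟ u
    ... | yes refl = contradiction (k , visit) unvisited
    ... | no _     = refl

  -- Prepend an edge u–w to W: if W visits u at an even step k, the edge and the first k steps of W
  -- form an odd closed segment; at an odd step the colouring of W already fits; else recolour u.
  oddClosedSegment-or-parityColouring : ∀ {u b} (W : Walk u b) → OddClosedSegment W ⊎ ParityColouring W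
  oddClosedSegment-or-parityColouring here = inj₂ ((λ _ → 0ℙ) , λ { start → refl })
  oddClosedSegment-or-parityColouring {u} (step {w = w} e s d W) with oddClosedSegment-or-parityColouring W
  ... | inj₁ (a , A , B , Q , eq , odd) = inj₁ (a , step e s d A , B , Q , cong (step e s d) eq , odd)
  ... | inj₂ (c , colours) with visits? W u
  ...   | no unvisited with recolour W unvisited c (c w ℙ.+ 1ℙ)
  ...     | c′ , c′u , agree =
    inj₂ (extend-parityColouring c′ (trans c′u (cong (ℙ._+ 1ℙ) (sym c′w)))
            (λ visit → trans (agree visit) (trans (colours visit) (cong (ℙ._+ _) (sym c′w)))))
    where
    c′w : c′ w ≡ c w
    c′w = agree start
  oddClosedSegment-or-parityColouring {u} (step {w = w} e s d W) | inj₂ (c , colours) | yes (k , visit)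
    with parity k in parity[k]
  ... | 1ℙ = inj₂ (extend-parityColouring c (trans (colours visit) (cong (c w ℙ.+_) parity[k])) colours)
  ... | 0ℙ with split visit
  ...   | P , Q , refl , refl = inj₁ (u , here , step e s d P , Q , refl , parity≡1ℙ⇒Odd (suc k) odd)
    where
    odd : parity (suc k) ≡ 1ℙ
    odd = trans (+-homo-+ 1 k) (cong (1ℙ ℙ.+_) parity[k])

  parityColouring⇒bipartite : ∀ {u b} (W : Walk u b) → (∀ e → e ∈ edges W) → ParityColouring W → Bipartite G
  parityColouring⇒bipartite {u} W covers (c , colours) = isOdd ∘ c , bichromatic
    where
    isOdd : Parity → Bool
    isOdd 0ℙ = false
    isOdd 1ℙ = true
    differ : ∀ a p → isOdd (a ℙ.+ p) ≢ isOdd (a ℙ.+ p ⁻¹)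
    differ 0ℙ 0ℙ = λ ()
    differ 0ℙ 1ℙ = λ ()
    differ 1ℙ 0ℙ = λ ()
    differ 1ℙ 1ℙ = λ ()
    consecutive : ∀ {k x y} → Visits W k x → Visits W (suc k) y → isOdd (c x) ≢ isOdd (c y)
    consecutive {k} visitX visitY rewrite colours visitX | colours visitY | +-homo-+ 1 k = differ (c u) (parity k)
    bichromatic : ∀ e → isOdd (c (proj₁ (ends G e))) ≢ isOdd (c (proj₂ (ends G e)))
    bichromatic e with edge-visits W (covers e)
    ... | k , x , y , inj₁ p , visitX , visitY rewrite p = consecutive visitX visitY
    ... | k , x , y , inj₂ p , visitX , visitY rewrite p = consecutive visitX visitY ∘ sym

  -- Euler circuits

  UnusedEdgeAt : ∀ {x y} → Walk x y → Vertex G → Set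
  UnusedEdgeAt T z = Σ (Edge G) λ f → f ∉ edges T × Σ (Vertex G) λ w → Joins f w z

  EulerCircuit : Set
  EulerCircuit = Σ (Vertex G) λ x → Σ (Walk x x) λ C → Unique (edges C) × (∀ e → e ∈ edges C)

  LongerTrail : ∀ {x y} → Walk x y → Set
  LongerTrail T = Σ (Vertex G) λ x′ → Σ (Vertex G) λ y′ → Σ (Walk x′ y′) λ T′ →
                  Unique (edges T′) × length (edges T′) ≡ suc (length (edges T))

  module _ (connected : ∀ u v → Walk u v) (evenDegrees : EvenDegrees G (allEdges G)) where

    -- T has an odd number of edge-ends at its start x, but x has even degree in G.
    openTrail-unusedEdge : ∀ {x y} → x ≢ y → (T : Walk x y) → Unique (edges T) → UnusedEdgeAt T x
    openTrail-unusedEdge {x} x≢y T unique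
      with any? (λ f → ¬? (f ∈? edges T) ×-dec ¬? (endsAt G f x ℕ.≟ 0))
    ... | yes (f , f∉T , endsAt≢0) = f , f∉T , endsAt≢0⇒joins endsAt≢0
    ... | no none = contradiction (subst (2 ∣_) degree≡endsAlong (evenDegrees x)) (open⇒¬2∣endsAlong x≢y T)
      where
      S : EdgeSet G
      S = _∈ᵇ edges T
      unusedEnds : ∀ f → (if not (S f) then endsAt G f x else 0) ≡ 0
      unusedEnds f with f ∈? edges T
      ... | yes _  = refl
      ... | no f∉T with endsAt G f x ℕ.≟ 0
      ...   | yes endsAt≡0 = endsAt≡0
      ...   | no endsAt≢0  = contradiction (f , f∉T , endsAt≢0) none
      unusedDegree : degree G (complement G S) x ≡ 0
      unusedDegree = trans (sum-map-allFin {m G} (λ f → if not (S f) then endsAt G f x else 0))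
                           (trans (sum-cong-≗ unusedEnds) (sum-replicate-zero (m G)))
      degree≡endsAlong : degree G (allEdges G) x ≡ endsAlong T x
      degree≡endsAlong = begin
        degree G (allEdges G) x                     ≡⟨ degree-split S x ⟩
        degree G S x + degree G (complement G S) x  ≡⟨ cong₂ _+_ (degree-enumeration x (∈ᵇ-enumeration unique))
                                                                 unusedDegree ⟩
        endsAlong T x + 0                           ≡⟨ +-identityʳ _ ⟩
        endsAlong T x                               ∎

    visited-unusedEdge : ∀ {x y u e} (T : Walk x y) → e ∉ edges T → Visited T u → Walk u (proj₁ (ends G e)) →
                         Σ (Vertex G) λ z → Visited T z × UnusedEdgeAt T z
    visited-unusedEdge {u = u} {e} T e∉T visit here = u , visit , e , e∉T , proj₂ (ends G e) , inj₂ refl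
    visited-unusedEdge {u = u} T e∉T visit (step {w = w} f _ d P) with f ∈? edges T
    ... | no f∉T  = u , visit , f , f∉T , w , joins-sym d
    ... | yes f∈T = visited-unusedEdge T e∉T (incident-visited T f∈T (joins⇒incident (joins-sym d))) P

    -- A closed trail missing an edge e is left, on the way from its start to e, at a visited vertex z
    -- with an unused edge; rotating the trail to start at z lets that edge be prepended.
    eulerCircuit-or-longerTrail : ∀ {x y} (T : Walk x y) → Unique (edges T) → EulerCircuit ⊎ LongerTrail T
    eulerCircuit-or-longerTrail {x} {y} T unique with x ≟ y
    ... | no x≢y with openTrail-unusedEdge x≢y T unique
    ...   | f , f∉T , w , joins = inj₂ (w , y , step f refl joins T , unique-∷ f∉T unique , refl)
    eulerCircuit-or-longerTrail {x} T unique | yes refl with all? (λ e → e ∈? edges T)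
    ... | yes covers = inj₁ (x , T , unique , covers)
    ... | no ¬covers with ¬∀⟶∃¬ _ _ (λ e → e ∈? edges T) ¬covers
    ...   | e , e∉T with visited-unusedEdge T e∉T (0 , start) (connected x (proj₁ (ends G e)))
    ...     | z , visit , f , f∉T , w , joins with rotate T visit
    ...       | T′ , T′↭T = inj₂ (w , z , step f refl joins T′ ,
                                  unique-∷ (f∉T ∘ ∈-resp-↭ T′↭T) (unique-↭ (↭-sym T′↭T) unique) ,
                                  cong suc (↭-length T′↭T))

    -- Trails have at most m G edges, so the fuel bounds the number of extensions still possible.
    eulerCircuit-from : ∀ {x y} (fuel : ℕ) (T : Walk x y) → Unique (edges T) → m G ≤ length (edges T) + fuel →
                        EulerCircuit
    eulerCircuit-from fuel T unique bound with eulerCircuit-or-longerTrail T unique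
    ... | inj₁ circuit = circuit
    eulerCircuit-from zero T _ bound | inj₂ (_ , _ , T′ , unique′ , longer) =
      contradiction (≤-trans (subst (_≤ m G) longer (unique⇒length≤ unique′))
                             (subst (m G ≤_) (+-identityʳ _) bound))
                    1+n≰n
    eulerCircuit-from (suc fuel) T _ bound | inj₂ (_ , _ , T′ , unique′ , longer) =
      eulerCircuit-from fuel T′ unique′
                        (subst (m G ≤_) (trans (+-suc _ fuel) (cong (_+ fuel) (sym longer))) bound)

    eulerCircuit : Vertex G → EulerCircuit
    eulerCircuit x = eulerCircuit-from (m G) (here {v = x}) [] ≤-refl

  oddClosedSegment⇒rootedTwoOddDecomposition :
    ∀ {x a} → 2 ∣ size G (allEdges G) → (A : Walk x a) (B : Walk a a) (Q : Walk a x) →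
    Unique (edges (A ++ʷ (B ++ʷ Q))) → (∀ e → e ∈ edges (A ++ʷ (B ++ʷ Q))) → Odd (length (edges B)) →
    RootedTwoOddDecomposition G
  oddClosedSegment⇒rootedTwoOddDecomposition {a = a} evenSize A B Q unique covers oddB =
    S , (proj₁ partB , proj₁ partR) , a , proj₂ partB , proj₂ partR
    where
    R : Walk a a
    R = Q ++ʷ A
    regroup : edges (A ++ʷ (B ++ʷ Q)) ↭ edges B ++ edges R
    regroup =
      ↭-trans (↭-reflexive (trans (edges-++ʷ A (B ++ʷ Q)) (cong (edges A ++_) (edges-++ʷ B Q))))
      (↭-trans (shifts (edges A) (edges B))
      (++⁺ˡ (edges B) (↭-trans (++-comm (edges A) (edges Q)) (↭-reflexive (sym (edges-++ʷ Q A))))))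
    S : EdgeSet G
    S = _∈ᵇ edges B
    enumerations : Enumeration S (edges B) × Enumeration (complement G S) (edges R)
    enumerations = partition-enumeration (edges B) (unique-↭ regroup unique) (∈-resp-↭ regroup ∘ covers)
    oddS : Odd (size G S)
    oddS = subst Odd (sym (size-enumeration (proj₁ enumerations))) oddB
    oddS̄ : Odd (size G (complement G S))
    oddS̄ = 2∣+Odd⇒Odd (subst (2 ∣_) (size-split S) evenSize) oddS
    partB : OddEulerianSub G S × InSub G S a
    partB = oddClosedTrail⇒rootedOddEulerianSub B (proj₁ enumerations) oddS
    partR : OddEulerianSub G (complement G S) × InSub G (complement G S) a
    partR = oddClosedTrail⇒rootedOddEulerianSub R (proj₂ enumerations) oddS̄

theorem4p1 : (G : Graph) → Eulerian G →
    RootedTwoOddDecomposition G ⇔ (¬ Bipartite G × Even (size G (allEdges G)))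
theorem4p1 G ((x₀ , connected) , evenDegrees) = mk⇔ necessary sufficient
  where
  necessary : RootedTwoOddDecomposition G → ¬ Bipartite G × Even (size G (allEdges G))
  necessary (S , ((eulerianS , oddS) , (_ , oddS̄)) , _) =
    (λ bipartite → Odd⇒¬2∣ oddS (bipartite⇒2∣size G bipartite S (proj₂ (proj₂ eulerianS)))) ,
    subst (2 ∣_) (sym (size-split G S)) (Odd+Odd⇒2∣ oddS oddS̄)

  sufficient : ¬ Bipartite G × Even (size G (allEdges G)) → RootedTwoOddDecomposition G
  sufficient (nonBipartite , evenSize) with eulerCircuit G connected evenDegrees x₀
  ... | _ , C , unique , covers with oddClosedSegment-or-parityColouring G C
  ...   | inj₁ (_ , A , B , Q , refl , oddB) =
    oddClosedSegment⇒rootedTwoOddDecomposition G evenSize A B Q unique covers oddB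
  ...   | inj₂ colouring = contradiction (parityColouring⇒bipartite G C covers colouring) nonBipartite
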